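{- Let $c_{n,k}$ be the number of paths in $\mathcal{A}_n$ with $k$ catastrophes, and $C(x,y)=\sum_{n,k\geq0}c_{n,k}x^ny^k$. Then $$C(x,y)=\frac{2}{2-2x^2-y\left(1-x-x^2-\sqrt{x^4-2x^3-x^2-2x+1}\right)}-1.$$
   Context: A Dyck path with air pockets is a non-empty lattice path in the first quadrant starting at the origin, ending on the $x$-axis, with up-steps $U=(1,1)$ and down-steps $D_k=(1,-k)$, $k\ge1$, no two down-steps consecutive. Its length is its number of steps; $\mathcal{A}_n$ is the set of such paths of length $n$. A catastrophe is a step $D_m$ with $m\geq2$ ending on the $x$-axis. -}

module Defs where

open import Data.Bool using (Bool; true; false; _∧_; not)
open import Data.Nat as ℕ using (ℕ; zero; suc; _∸_; _≡ᵇ_; _≤ᵇ_)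
open import Data.List using (List; []; _∷_; map; length; filterᵇ; concatMap; applyUpTo; sum; foldr)
open import Data.Integer using (+_)
open import Data.Rational using (ℚ; 0ℚ; 1ℚ; _+_; _*_; -_; _/_)
open import Relation.Binary.PropositionalEquality using (_≡_)

-- up = U = (1,1);  down k = D_k = (1,-k)  (validity requires k ≥ 1)
data Step : Set where
  up   : Step
  down : ℕ → Step

walk : ℕ → Bool → List Step → Bool
walk h pd []             = h ≡ᵇ 0
walk h pd (up ∷ w)       = walk (suc h) false w
walk h pd (down k ∷ w)   = not pd ∧ (1 ≤ᵇ k) ∧ (k ≤ᵇ h) ∧ walk (h ∸ k) true w

isAirPath : List Step → Bool
isAirPath []      = false
isAirPath (s ∷ w) = walk 0 false (s ∷ w)

catastrophes : ℕ → List Step → ℕ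
catastrophes h []           = 0
catastrophes h (up ∷ w)     = catastrophes (suc h) w
catastrophes h (down m ∷ w) with (2 ≤ᵇ m) ∧ (h ∸ m ≡ᵇ 0)
... | true  = suc (catastrophes (h ∸ m) w)
... | false = catastrophes (h ∸ m) w

-- all step words of length n whose down-steps have size in 1..n
-- (every path of length n has all down-step sizes ≤ n, since the
-- height never exceeds n; so this enumerates a superset of 𝒜_n)
stepsUpTo : ℕ → List Step
stepsUpTo n = up ∷ applyUpTo (λ i → down (suc i)) n

words : ℕ → ℕ → List (List Step)
words b zero    = [] ∷ []
words b (suc n) = concatMap (λ s → map (s ∷_) (words b n)) (stepsUpTo b)

𝒜 : ℕ → List (List Step)
𝒜 n = filterᵇ isAirPath (words n n)

c : ℕ → ℕ → ℕ
c n k = length (filterᵇ (λ w → catastrophes 0 w ≡ᵇ k) (𝒜 n))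

-- Formal power series in x, y over ℚ:  f n k = coefficient of x^n y^k

FPS : Set
FPS = ℕ → ℕ → ℚ

ℕtoℚ : ℕ → ℚ
ℕtoℚ n = + n / 1

_≈ₛ_ : FPS → FPS → Set
f ≈ₛ g = ∀ n k → f n k ≡ g n k

infix 4 _≈ₛ_
infixl 6 _+ₛ_ _-ₛ_
infixl 7 _·ₛ_

_+ₛ_ : FPS → FPS → FPS
(f +ₛ g) n k = f n k + g n k

negₛ : FPS → FPS
negₛ f n k = - f n k

_-ₛ_ : FPS → FPS → FPS
f -ₛ g = f +ₛ negₛ g

sumℚ : List ℚ → ℚ
sumℚ = foldr _+_ 0ℚ

_·ₛ_ : FPS → FPS → FPS
(f ·ₛ g) n k =
  sumℚ (applyUpTo (λ i → sumℚ (applyUpTo (λ j →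
      f i j * g (n ∸ i) (k ∸ j)) (suc k))) (suc n))

constₛ : ℚ → FPS
constₛ a zero zero = a
constₛ a _    _    = 0ℚ

mono : ℕ → ℕ → FPS
mono a b n k with (n ≡ᵇ a) ∧ (k ≡ᵇ b)
... | true  = 1ℚ
... | false = 0ℚ

X Y : FPS
X = mono 1 0
Y = mono 0 1

Cgf : FPS
Cgf n k = ℕtoℚ (c n k)

radicand : FPS
radicand = mono 4 0 -ₛ constₛ (ℕtoℚ 2) ·ₛ mono 3 0 -ₛ mono 2 0
           -ₛ constₛ (ℕtoℚ 2) ·ₛ X +ₛ constₛ 1ℚ

denom : FPS → FPS
denom S = constₛ (ℕtoℚ 2) -ₛ constₛ (ℕtoℚ 2) ·ₛ mono 2 0
          -ₛ Y ·ₛ (constₛ 1ℚ -ₛ X -ₛ mono 2 0 -ₛ S)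

-- Cutting a path at its returns to the x-axis shows that P = C + 1 satisfies
-- P = 1 + x²P + y·a·P, where a(x) counts the arches: paths whose only return to the
-- axis is their last step, a catastrophe (x² accounts for the returns by U D₁).
-- Lowering an arch by one level and cutting it where it first reaches height 1 gives
-- a = x³ + (x + x²)·a + a², so (1 - x - x² - 2a)² = x⁴ - 2x³ - x² - 2x + 1.  A series
-- with constant term 1 is determined by its square, hence S = 1 - x - x² - 2a, the
-- denominator is 2(1 - x² - y·a), and the claim is twice the equation for P.

module Submission where

open import Defs
open import Data.Rational using (1ℚ)
open import Relation.Binary.PropositionalEquality using (_≡_)
open import Algebra.Bundles using (CommutativeSemiring; CommutativeRing)

module Convolution {c ℓ} (R : CommutativeSemiring c ℓ) where

  open import Data.Nat using (ℕ; zero; suc; _∸_; _<_; _≤_; z≤n; s≤s)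
  open import Data.Nat.Induction using (<-rec)
  open import Data.Nat.Properties using (m∸[m∸n]≡n)
  open import Data.Fin using (Fin; toℕ; opposite)
  open import Data.Fin.Properties using (opposite-prop; toℕ≤pred[n]; toℕ-inject₁; toℕ-fromℕ; toℕ<n)
  open import Data.Fin.Permutation using (reverse)
  import Relation.Binary.PropositionalEquality as ≡

  open CommutativeSemiring R
  open import Algebra.Properties.Semiring.Sum semiring public
  open import Relation.Binary.Reasoning.Setoid setoid

  ∑-zero : ∀ {n} (t : Fin n → Carrier) → (∀ i → t i ≈ 0#) → sum t ≈ 0#
  ∑-zero {n} t t≈0 = trans (sum-cong-≋ t≈0) (sum-replicate-zero n)

  ∑-reverse : ∀ n (f : ℕ → Carrier) → ∑[ i < n ] f (toℕ i) ≈ ∑[ i < n ] f (n ∸ suc (toℕ i))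
  ∑-reverse n f = trans (sum-permute (λ i → f (toℕ i)) (reverse {n}))
                        (reflexive (sum-cong-≗ (λ (i : Fin n) → ≡.cong f (opposite-prop i))))

  ∑≤-last : ∀ n (f : ℕ → Carrier) → ∑[ i ≤ n ] f (toℕ i) ≈ ∑[ i < n ] f (toℕ i) + f n
  ∑≤-last n f = trans (sum-init-last {n} (λ i → f (toℕ i)))
    (+-cong (reflexive (sum-cong-≗ {n} (λ i → ≡.cong f (toℕ-inject₁ i)))) (reflexive (≡.cong f (toℕ-fromℕ n))))

  ∑-truncate : ∀ {n b} (f : ℕ → Carrier) → n ≤ b → (∀ i → n ≤ i → f i ≈ 0#) →
               ∑[ i < b ] f (toℕ i) ≈ ∑[ i < n ] f (toℕ i)
  ∑-truncate {zero}  {b}     f _         vanish = ∑-zero {b} _ (λ i → vanish (toℕ i) z≤n)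
  ∑-truncate {suc n} {suc b} f (s≤s n≤b) vanish =
    +-congˡ (∑-truncate (λ i → f (suc i)) n≤b (λ i n≤i → vanish (suc i) (s≤s n≤i)))

  infixl 7 _⋆_

  _⋆_ : (ℕ → Carrier) → (ℕ → Carrier) → ℕ → Carrier
  (f ⋆ g) n = ∑[ i ≤ n ] (f (toℕ i) * g (n ∸ toℕ i))

  ⋆-cong : ∀ {f f′ g g′} n → (∀ i → f i ≈ f′ i) → (∀ i → g i ≈ g′ i) → (f ⋆ g) n ≈ (f′ ⋆ g′) n
  ⋆-cong n f≈f′ g≈g′ = sum-cong-≋ {suc n} (λ i → *-cong (f≈f′ (toℕ i)) (g≈g′ (n ∸ toℕ i)))

  ⋆-comm : ∀ f g n → (f ⋆ g) n ≈ (g ⋆ f) n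
  ⋆-comm f g n = begin
    ∑[ i ≤ n ] (f (toℕ i) * g (n ∸ toℕ i))             ≈⟨ ∑-reverse (suc n) (λ i → f i * g (n ∸ i)) ⟩
    ∑[ i ≤ n ] (f (n ∸ toℕ i) * g (n ∸ (n ∸ toℕ i)))   ≈⟨ sum-cong-≋ swap ⟩
    ∑[ i ≤ n ] (g (toℕ i) * f (n ∸ toℕ i))             ∎
    where
    swap : ∀ (i : Fin (suc n)) → f (n ∸ toℕ i) * g (n ∸ (n ∸ toℕ i)) ≈ g (toℕ i) * f (n ∸ toℕ i)
    swap i = trans (*-comm _ _) (*-congʳ (reflexive (≡.cong g (m∸[m∸n]≡n (toℕ≤pred[n] i)))))

  ⋆-distribʳ-+ : ∀ f g h n → ((λ i → f i + g i) ⋆ h) n ≈ (f ⋆ h) n + (g ⋆ h) n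
  ⋆-distribʳ-+ f g h n = trans (sum-cong-≋ {suc n} (λ i → distribʳ (h (n ∸ toℕ i)) (f (toℕ i)) (g (toℕ i))))
    (∑-distrib-+ {suc n} (λ i → f (toℕ i) * h (n ∸ toℕ i)) (λ i → g (toℕ i) * h (n ∸ toℕ i)))

  ⋆-scaleˡ : ∀ c f g n → ((λ i → c * f i) ⋆ g) n ≈ c * (f ⋆ g) n
  ⋆-scaleˡ c f g n = trans (sum-cong-≋ {suc n} (λ i → *-assoc c (f (toℕ i)) (g (n ∸ toℕ i))))
                           (sym (*-distribˡ-sum {suc n} c (λ i → f (toℕ i) * g (n ∸ toℕ i))))

  ⋆-affineˡ : ∀ f c g h n → ((λ i → f i + c * g i) ⋆ h) n ≈ (f ⋆ h) n + c * (g ⋆ h) n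
  ⋆-affineˡ f c g h n = trans (⋆-distribʳ-+ f (λ i → c * g i) h n) (+-congˡ (⋆-scaleˡ c g h n))

  ⋆-zeroˡ : ∀ f g n → (∀ i → f i ≈ 0#) → (f ⋆ g) n ≈ 0#
  ⋆-zeroˡ f g n f≈0 = ∑-zero {suc n} _ (λ i → trans (*-congʳ (f≈0 (toℕ i))) (zeroˡ (g (n ∸ toℕ i))))

  ⋆-headˡ : ∀ f g n → (∀ i → f (suc i) ≈ 0#) → (f ⋆ g) n ≈ f 0 * g n
  ⋆-headˡ f g n tail≈0 =
    trans (+-congˡ (∑-zero {n} _ (λ i → trans (*-congʳ (tail≈0 (toℕ i))) (zeroˡ (g (n ∸ suc (toℕ i))))))) (+-identityʳ _)

  ⋆-degree≤2ˡ : ∀ f g n → (∀ i → f (suc (suc (suc i))) ≈ 0#) →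
                (f ⋆ g) (suc (suc n)) ≈ f 0 * g (suc (suc n)) + (f 1 * g (suc n) + f 2 * g n)
  ⋆-degree≤2ˡ f g n high≈0 = +-congˡ (+-congˡ (trans (+-congˡ tail≈0) (+-identityʳ _)))
    where
    tail≈0 : ∑[ i < n ] (f (suc (suc (suc (toℕ i)))) * g (n ∸ suc (toℕ i))) ≈ 0#
    tail≈0 = ∑-zero {n} _ (λ i → trans (*-congʳ (high≈0 (toℕ i))) (zeroˡ (g (n ∸ suc (toℕ i)))))

  ⋆-cancelˡ : ∀ {u} t g → u * t 0 ≈ 1# → (∀ n → (t ⋆ g) n ≈ 0#) → ∀ n → g n ≈ 0#
  ⋆-cancelˡ {u} t g unit t⋆g≈0 = <-rec (λ n → g n ≈ 0#) step
    where
    step : ∀ n → (∀ {m} → m < n → g m ≈ 0#) → g n ≈ 0#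
    step n below = begin
      g n              ≈⟨ sym (*-identityˡ (g n)) ⟩
      1# * g n         ≈⟨ *-congʳ (sym unit) ⟩
      (u * t 0) * g n  ≈⟨ *-assoc u (t 0) (g n) ⟩
      u * (t 0 * g n)  ≈⟨ *-congˡ leading ⟩
      u * 0#           ≈⟨ zeroʳ u ⟩
      0#               ∎
      where
      below-opposite : ∀ (i : Fin n) → g (n ∸ suc (toℕ i)) ≈ 0#
      below-opposite i = below (≡.subst (_< n) (opposite-prop i) (toℕ<n (opposite i)))
      tail≈0 : ∑[ i < n ] (t (suc (toℕ i)) * g (n ∸ suc (toℕ i))) ≈ 0#
      tail≈0 = ∑-zero {n} _ (λ i → trans (*-congˡ (below-opposite i)) (zeroʳ _))
      leading : t 0 * g n ≈ 0#
      leading = begin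
        t 0 * g n                                                      ≈⟨ sym (+-identityʳ _) ⟩
        t 0 * g n + 0#                                                 ≈⟨ +-congˡ (sym tail≈0) ⟩
        t 0 * g n + ∑[ i < n ] (t (suc (toℕ i)) * g (n ∸ suc (toℕ i))) ≈⟨ t⋆g≈0 n ⟩
        0#                                                             ∎


module Walks where

  open import Data.Bool using (Bool; true; false; _∧_; if_then_else_)
  open import Data.Bool.Properties using (∧-zeroʳ; T-≡)
  open import Data.Nat using (ℕ; zero; suc; _+_; _*_; _∸_; _≤_; _<_; _≤ᵇ_; _≡ᵇ_; s≤s)
  open import Data.Nat.Properties
  open import Algebra.Properties.CommutativeSemigroup +-commutativeSemigroup using (interchange)
  open import Data.Fin using (Fin; toℕ)
  open import Data.Fin.Properties using (toℕ<n)
  open import Data.List using (List; []; _∷_; _++_; map; length; filterᵇ; concatMap; applyUpTo)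
  open import Function.Bundles using (Equivalence)
  open import Relation.Binary.PropositionalEquality

  open Convolution +-*-commutativeSemiring

  count : {A : Set} → (A → Bool) → List A → ℕ
  count p []       = 0
  count p (x ∷ xs) = if p x then suc (count p xs) else count p xs

  length-filterᵇ : {A : Set} (p : A → Bool) (xs : List A) → length (filterᵇ p xs) ≡ count p xs
  length-filterᵇ p [] = refl
  length-filterᵇ p (x ∷ xs) with p x
  ... | true  = cong suc (length-filterᵇ p xs)
  ... | false = length-filterᵇ p xs

  count-filterᵇ : {A : Set} (p q : A → Bool) (xs : List A) →
                  count q (filterᵇ p xs) ≡ count (λ x → p x ∧ q x) xs
  count-filterᵇ p q [] = refl
  count-filterᵇ p q (x ∷ xs) with p x
  ... | false = count-filterᵇ p q xs
  ... | true with q x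
  ...   | true  = cong suc (count-filterᵇ p q xs)
  ...   | false = count-filterᵇ p q xs

  count-++ : {A : Set} (p : A → Bool) (xs ys : List A) → count p (xs ++ ys) ≡ count p xs + count p ys
  count-++ p [] ys = refl
  count-++ p (x ∷ xs) ys with p x
  ... | true  = cong suc (count-++ p xs ys)
  ... | false = count-++ p xs ys

  count-map : {A B : Set} (p : B → Bool) (f : A → B) (xs : List A) → count p (map f xs) ≡ count (λ x → p (f x)) xs
  count-map p f [] = refl
  count-map p f (x ∷ xs) with p (f x)
  ... | true  = cong suc (count-map p f xs)
  ... | false = count-map p f xs

  count-cong : {A : Set} {p q : A → Bool} → (∀ x → p x ≡ q x) → (xs : List A) → count p xs ≡ count q xs
  count-cong p≗q [] = refl
  count-cong {q = q} p≗q (x ∷ xs) rewrite p≗q x = cong (λ n → if q x then suc n else n) (count-cong p≗q xs)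

  count-false : {A : Set} (xs : List A) → count (λ _ → false) xs ≡ 0
  count-false [] = refl
  count-false (x ∷ xs) = count-false xs

  count-words-suc : ∀ (p : List Step → Bool) b m →
    count p (words b (suc m)) ≡
      count (λ w → p (up ∷ w)) (words b m) + ∑[ i < b ] count (λ w → p (down (suc (toℕ i)) ∷ w)) (words b m)
  count-words-suc p b m = begin
    count p (map (up ∷_) W ++ concatMap (λ s → map (s ∷_) W) (applyUpTo (λ i → down (suc i)) b))
      ≡⟨ count-++ p (map (up ∷_) W) _ ⟩
    count p (map (up ∷_) W) + count p (concatMap (λ s → map (s ∷_) W) (applyUpTo (λ i → down (suc i)) b))
      ≡⟨ cong₂ _+_ (count-map p (up ∷_) W) (downs b (λ i → down (suc i))) ⟩
    count (λ w → p (up ∷ w)) W + ∑[ i < b ] count (λ w → p (down (suc (toℕ i)) ∷ w)) W ∎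
    where
    open ≡-Reasoning
    W = words b m
    downs : ∀ n (s : ℕ → Step) →
            count p (concatMap (λ s → map (s ∷_) W) (applyUpTo s n)) ≡ ∑[ i < n ] count (λ w → p (s (toℕ i) ∷ w)) W
    downs zero    s = refl
    downs (suc n) s = trans (count-++ p (map (s 0 ∷_) W) _)
                            (cong₂ _+_ (count-map p (s 0 ∷_) W) (downs n (λ i → s (suc i))))

  yShift : (ℕ → ℕ) → ℕ → ℕ
  yShift g zero    = 0
  yShift g (suc k) = g k

  -- The down-steps allowed at height h: to the axis from height d + 1, weighted land d,
  -- or to a height t + 1 > 0, weighted cont (t + 1).
  downSteps : (ℕ → ℕ) → (ℕ → ℕ) → ℕ → Bool → ℕ
  downSteps land cont h       true  = 0
  downSteps land cont zero    false = 0
  downSteps land cont (suc h) false = land h + ∑[ t < h ] cont (suc (toℕ t))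

  -- A step to the axis from height d + 1 is a catastrophe iff d ≥ 1.
  afterLanding : (ℕ → ℕ) → ℕ → ℕ → ℕ
  afterLanding g zero    = g
  afterLanding g (suc d) = yShift g

  afterLanding-cong : ∀ {g g′} d k → (∀ k → g k ≡ g′ k) → afterLanding g d k ≡ afterLanding g′ d k
  afterLanding-cong zero    k       g≗g′ = g≗g′ k
  afterLanding-cong (suc d) zero    g≗g′ = refl
  afterLanding-cong (suc d) (suc k) g≗g′ = g≗g′ k

  -- walks m h pd k counts the step sequences of length m that continue a walk standing at
  -- height h (pd: its last step was a down-step) to the x-axis with k catastrophes.
  walks : ℕ → ℕ → Bool → ℕ → ℕ
  walks zero    zero    pd zero    = 1
  walks zero    zero    pd (suc k) = 0
  walks zero    (suc h) pd k       = 0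
  walks (suc m) h       pd k       =
    walks m (suc h) false k + downSteps (λ d → afterLanding (walks m 0 true) d k) (λ h′ → walks m h′ true k) h pd

  paths : ℕ → ℕ → ℕ
  paths n k = walks n 0 true k

  isWalk : ℕ → Bool → ℕ → List Step → Bool
  isWalk h pd k w = walk h pd w ∧ (catastrophes h w ≡ᵇ k)

  catastrophes-down : ∀ h d w → catastrophes h (down d ∷ w) ≡
    (if (2 ≤ᵇ d) ∧ (h ∸ d ≡ᵇ 0) then suc (catastrophes (h ∸ d) w) else catastrophes (h ∸ d) w)
  catastrophes-down h d w with (2 ≤ᵇ d) ∧ (h ∸ d ≡ᵇ 0)
  ... | true  = refl
  ... | false = refl

  ≤ᵇ-true : ∀ {m n} → m ≤ n → (m ≤ᵇ n) ≡ true
  ≤ᵇ-true m≤n = Equivalence.to T-≡ (≤⇒≤ᵇ m≤n)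

  ≤ᵇ-false : ∀ {m n} → n < m → (m ≤ᵇ n) ≡ false
  ≤ᵇ-false {suc m}       {zero}  _         = refl
  ≤ᵇ-false {suc (suc m)} {suc n} (s≤s n<m) = ≤ᵇ-false {suc m} {n} n<m

  isWalk-down-inner : ∀ h i k w → i < h → isWalk (suc h) false k (down (suc i) ∷ w) ≡ isWalk (h ∸ i) true k w
  isWalk-down-inner h i k w i<h
    rewrite catastrophes-down (suc h) (suc i) w | ≤ᵇ-true (s≤s (<⇒≤ i<h)) | +-∸-assoc 1 i<h | ∧-zeroʳ (2 ≤ᵇ suc i) = refl

  isWalk-down-catastrophe : ∀ h k w → isWalk (2 + h) false k (down (2 + h) ∷ w) ≡ walk 0 true w ∧ (suc (catastrophes 0 w) ≡ᵇ k)
  isWalk-down-catastrophe h k w rewrite catastrophes-down (2 + h) (2 + h) w | ≤ᵇ-true (≤-refl {2 + h}) | n∸n≡0 h = refl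

  isWalk-down-too-far : ∀ h i k w → h ≤ i → isWalk h false k (down (suc i) ∷ w) ≡ false
  isWalk-down-too-far h i k w h≤i rewrite ≤ᵇ-false (s≤s h≤i) = refl

  count-landing : ∀ h k W → count (λ w → isWalk (suc h) false k (down (suc h) ∷ w)) W ≡ afterLanding (λ k → count (isWalk 0 true k) W) h k
  count-landing zero     k       W = refl
  count-landing (suc h) zero    W =
    trans (count-cong (λ w → trans (isWalk-down-catastrophe h 0 w) (∧-zeroʳ (walk 0 true w))) W) (count-false W)
  count-landing (suc h) (suc k) W = count-cong (λ w → isWalk-down-catastrophe h (suc k) w) W

  count-downSteps : ∀ b m h k → suc h + suc m ≤ b →
    (∀ h′ k → h′ + m ≤ b → count (isWalk h′ true k) (words b m) ≡ walks m h′ true k) →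
    ∑[ i < b ] count (λ w → isWalk (suc h) false k (down (suc (toℕ i)) ∷ w)) (words b m) ≡
    downSteps (λ d → afterLanding (walks m 0 true) d k) (λ h′ → walks m h′ true k) (suc h) false
  count-downSteps b m h k bound walks-count-m = begin
    ∑[ i < b ] C (toℕ i)
      ≡⟨ ∑-truncate C (≤-trans (m≤m+n (suc h) (suc m)) bound)
                    (λ i h<i → trans (count-cong (λ w → isWalk-down-too-far (suc h) i k w h<i) W) (count-false W)) ⟩
    ∑[ i < suc h ] C (toℕ i)
      ≡⟨ ∑≤-last h C ⟩
    ∑[ i < h ] C (toℕ i) + C h
      ≡⟨ cong₂ _+_ (sum-cong-≗ {h} inner) (trans (count-landing h k W) landing) ⟩
    ∑[ i < h ] walks m (suc (h ∸ suc (toℕ i))) true k + afterLanding (walks m 0 true) h k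
      ≡⟨ cong (_+ afterLanding (walks m 0 true) h k) (∑-reverse h (λ t → walks m (suc t) true k)) ⟨
    ∑[ t < h ] walks m (suc (toℕ t)) true k + afterLanding (walks m 0 true) h k
      ≡⟨ +-comm _ (afterLanding (walks m 0 true) h k) ⟩
    afterLanding (walks m 0 true) h k + ∑[ t < h ] walks m (suc (toℕ t)) true k ∎
    where
    open ≡-Reasoning
    W = words b m
    C : ℕ → ℕ
    C i = count (λ w → isWalk (suc h) false k (down (suc i) ∷ w)) W
    inner : ∀ (i : Fin h) → C (toℕ i) ≡ walks m (suc (h ∸ suc (toℕ i))) true k
    inner i = begin
      C (toℕ i)                                 ≡⟨ count-cong (λ w → isWalk-down-inner h (toℕ i) k w (toℕ<n i)) W ⟩
      count (isWalk (h ∸ toℕ i) true k) W       ≡⟨ walks-count-m (h ∸ toℕ i) k (≤-trans (+-monoˡ-≤ m (m∸n≤m h (toℕ i))) h+m≤b) ⟩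
      walks m (h ∸ toℕ i) true k                ≡⟨ cong (λ h′ → walks m h′ true k) (+-∸-assoc 1 (toℕ<n i)) ⟩
      walks m (suc (h ∸ suc (toℕ i))) true k    ∎
      where
      h+m≤b : h + m ≤ b
      h+m≤b = ≤-trans (+-mono-≤ (n≤1+n h) (n≤1+n m)) bound
    landing : afterLanding (λ k → count (isWalk 0 true k) W) h k ≡ afterLanding (walks m 0 true) h k
    landing = afterLanding-cong h k (λ k → walks-count-m 0 k (≤-trans (≤-trans (n≤1+n m) (m≤n+m (suc m) (suc h))) bound))

  walks-count : ∀ b m h pd k → h + m ≤ b → count (isWalk h pd k) (words b m) ≡ walks m h pd k
  walks-count b zero    zero    pd zero    _     = refl
  walks-count b zero    zero    pd (suc k) _     = refl
  walks-count b zero    (suc h) pd k       _     = refl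
  walks-count b (suc m) h       pd k       bound =
    trans (count-words-suc (isWalk h pd k) b m)
          (cong₂ _+_ (walks-count b m (suc h) false k (≤-trans (≤-reflexive (sym (+-suc h m))) bound)) (downs pd h bound))
    where
    downs : ∀ pd h → h + suc m ≤ b →
            ∑[ i < b ] count (λ w → isWalk h pd k (down (suc (toℕ i)) ∷ w)) (words b m) ≡
            downSteps (λ d → afterLanding (walks m 0 true) d k) (λ h′ → walks m h′ true k) h pd
    downs true  h       _     = ∑-zero {b} _ (λ _ → count-false (words b m))
    downs false zero    _     = ∑-zero {b} _ (λ _ → count-false (words b m))
    downs false (suc h) bound = count-downSteps b m h k bound (λ h′ k → walks-count b m h′ true k)

  count-words-suc-cong : ∀ {p q : List Step → Bool} b m → (∀ s w → p (s ∷ w) ≡ q (s ∷ w)) →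
                         count p (words b (suc m)) ≡ count q (words b (suc m))
  count-words-suc-cong {p} {q} b m p≗q = begin
    count p (words b (suc m))
      ≡⟨ count-words-suc p b m ⟩
    count (λ w → p (up ∷ w)) W + ∑[ i < b ] count (λ w → p (down (suc (toℕ i)) ∷ w)) W
      ≡⟨ cong₂ _+_ (count-cong (p≗q up) W) (sum-cong-≗ {b} (λ i → count-cong (p≗q (down (suc (toℕ i)))) W)) ⟩
    count (λ w → q (up ∷ w)) W + ∑[ i < b ] count (λ w → q (down (suc (toℕ i)) ∷ w)) W
      ≡⟨ count-words-suc q b m ⟨
    count q (words b (suc m)) ∎
    where
    open ≡-Reasoning
    W = words b m

  c-paths : ∀ m k → c (suc m) k ≡ paths (suc m) k
  c-paths m k = begin
    length (filterᵇ (λ w → catastrophes 0 w ≡ᵇ k) (filterᵇ isAirPath (words (suc m) (suc m))))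
      ≡⟨ length-filterᵇ _ (filterᵇ isAirPath (words (suc m) (suc m))) ⟩
    count (λ w → catastrophes 0 w ≡ᵇ k) (filterᵇ isAirPath (words (suc m) (suc m)))
      ≡⟨ count-filterᵇ isAirPath _ (words (suc m) (suc m)) ⟩
    count (λ w → isAirPath w ∧ (catastrophes 0 w ≡ᵇ k)) (words (suc m) (suc m))
      ≡⟨ count-words-suc-cong (suc m) m (λ _ _ → refl) ⟩
    count (isWalk 0 false k) (words (suc m) (suc m))
      ≡⟨ walks-count (suc m) (suc m) 0 false k ≤-refl ⟩
    paths (suc m) k ∎
    where open ≡-Reasoning

  -- Walks from height h that stay above the axis until a step onto it; such a step from
  -- height d + 1, with j of the m steps still to go, contributes e j d.
  firstPassages : (ℕ → ℕ → ℕ) → ℕ → ℕ → Bool → ℕ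
  firstPassages e zero    h pd = 0
  firstPassages e (suc m) h pd =
    firstPassages e m (suc h) false + downSteps (e m) (λ h′ → firstPassages e m h′ true) h pd

  downSteps-cong : ∀ {l l′ c c′} h pd → (∀ d → l d ≡ l′ d) → (∀ h′ → c (suc h′) ≡ c′ (suc h′)) →
                   downSteps l c h pd ≡ downSteps l′ c′ h pd
  downSteps-cong h       true  _   _   = refl
  downSteps-cong zero    false _   _   = refl
  downSteps-cong (suc h) false l≗l′ c≗c′ = cong₂ _+_ (l≗l′ h) (sum-cong-≗ {h} (λ t → c≗c′ (toℕ t)))

  downSteps-+ : ∀ l l′ c c′ h pd →
    downSteps (λ d → l d + l′ d) (λ h′ → c h′ + c′ h′) h pd ≡ downSteps l c h pd + downSteps l′ c′ h pd
  downSteps-+ l l′ c c′ h       true  = refl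
  downSteps-+ l l′ c c′ zero    false = refl
  downSteps-+ l l′ c c′ (suc h) false = begin
    (l h + l′ h) + ∑[ t < h ] (c (suc (toℕ t)) + c′ (suc (toℕ t)))
      ≡⟨ cong ((l h + l′ h) +_) (∑-distrib-+ {h} (λ t → c (suc (toℕ t))) (λ t → c′ (suc (toℕ t)))) ⟩
    (l h + l′ h) + (∑[ t < h ] c (suc (toℕ t)) + ∑[ t < h ] c′ (suc (toℕ t)))
      ≡⟨ interchange (l h) (l′ h) _ _ ⟩
    (l h + ∑[ t < h ] c (suc (toℕ t))) + (l′ h + ∑[ t < h ] c′ (suc (toℕ t))) ∎
    where open ≡-Reasoning

  downSteps-⋆ : ∀ (l c : ℕ → ℕ → ℕ) K m h pd →
    downSteps (λ d → ((λ j → l j d) ⋆ K) m) (λ h′ → ((λ j → c j h′) ⋆ K) m) h pd ≡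
    ((λ j → downSteps (l j) (c j) h pd) ⋆ K) m
  downSteps-⋆ l c K m h       true  = sym (∑-zero {suc m} _ (λ _ → refl))
  downSteps-⋆ l c K m zero    false = sym (∑-zero {suc m} _ (λ _ → refl))
  downSteps-⋆ l c K m (suc h) false = sym (begin
    ∑[ j ≤ m ] ((l (toℕ j) h + ∑[ t < h ] c (toℕ j) (suc (toℕ t))) * K (m ∸ toℕ j))
      ≡⟨ sum-cong-≗ {suc m} (λ j → trans (*-distribʳ-+ (K (m ∸ toℕ j)) (l (toℕ j) h) (∑[ t < h ] c (toℕ j) (suc (toℕ t))))
                                           (cong (l (toℕ j) h * K (m ∸ toℕ j) +_) (*-distribʳ-sum {h} (K (m ∸ toℕ j)) (λ t → c (toℕ j) (suc (toℕ t)))))) ⟩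
    ∑[ j ≤ m ] (l (toℕ j) h * K (m ∸ toℕ j) + ∑[ t < h ] (c (toℕ j) (suc (toℕ t)) * K (m ∸ toℕ j)))
      ≡⟨ ∑-distrib-+ {suc m} (λ j → l (toℕ j) h * K (m ∸ toℕ j)) (λ j → ∑[ t < h ] (c (toℕ j) (suc (toℕ t)) * K (m ∸ toℕ j))) ⟩
    ((λ j → l j h) ⋆ K) m + ∑[ j ≤ m ] ∑[ t < h ] (c (toℕ j) (suc (toℕ t)) * K (m ∸ toℕ j))
      ≡⟨ cong (((λ j → l j h) ⋆ K) m +_) (∑-comm {suc m} {h} (λ j t → c (toℕ j) (suc (toℕ t)) * K (m ∸ toℕ j))) ⟩
    ((λ j → l j h) ⋆ K) m + ∑[ t < h ] ((λ j → c j (suc (toℕ t))) ⋆ K) m ∎)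
    where open ≡-Reasoning

  firstPassages-cong : ∀ {e e′} → (∀ m d → e m d ≡ e′ m d) → ∀ m h pd → firstPassages e m h pd ≡ firstPassages e′ m h pd
  firstPassages-cong e≗e′ zero    h pd = refl
  firstPassages-cong e≗e′ (suc m) h pd =
    cong₂ _+_ (firstPassages-cong e≗e′ m (suc h) false)
              (downSteps-cong h pd (e≗e′ m) (λ h′ → firstPassages-cong e≗e′ m (suc h′) true))

  firstPassages-+ : ∀ e e′ m h pd →
    firstPassages (λ m d → e m d + e′ m d) m h pd ≡ firstPassages e m h pd + firstPassages e′ m h pd
  firstPassages-+ e e′ zero    h pd = refl
  firstPassages-+ e e′ (suc m) h pd = begin
    firstPassages e+e′ m (suc h) false + downSteps (λ d → e m d + e′ m d) (λ h′ → firstPassages e+e′ m h′ true) h pd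
      ≡⟨ cong₂ _+_ (firstPassages-+ e e′ m (suc h) false)
                   (trans (downSteps-cong h pd (λ _ → refl) (λ h′ → firstPassages-+ e e′ m (suc h′) true))
                          (downSteps-+ (e m) (e′ m) (λ h′ → firstPassages e m h′ true) (λ h′ → firstPassages e′ m h′ true) h pd)) ⟩
    (firstPassages e m (suc h) false + firstPassages e′ m (suc h) false) +
    (downSteps (e m) (λ h′ → firstPassages e m h′ true) h pd + downSteps (e′ m) (λ h′ → firstPassages e′ m h′ true) h pd)
      ≡⟨ interchange (firstPassages e m (suc h) false) (firstPassages e′ m (suc h) false)
                     (downSteps (e m) (λ h′ → firstPassages e m h′ true) h pd) (downSteps (e′ m) (λ h′ → firstPassages e′ m h′ true) h pd) ⟩
    firstPassages e (suc m) h pd + firstPassages e′ (suc m) h pd ∎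
    where
    open ≡-Reasoning
    e+e′ = λ m d → e m d + e′ m d

  firstPassages-⋆ : ∀ e K m h pd →
    firstPassages (λ m d → ((λ j → e j d) ⋆ K) m) m h pd ≡ ((λ j → firstPassages e j h pd) ⋆ K) m
  firstPassages-⋆ e K zero    h pd = refl
  firstPassages-⋆ e K (suc m) h pd = begin
    firstPassages e⋆K m (suc h) false + downSteps (e⋆K m) (λ h′ → firstPassages e⋆K m h′ true) h pd
      ≡⟨ cong₂ _+_ (firstPassages-⋆ e K m (suc h) false)
                   (trans (downSteps-cong h pd (λ _ → refl) (λ h′ → firstPassages-⋆ e K m (suc h′) true))
                          (downSteps-⋆ e (λ j h′ → firstPassages e j h′ true) K m h pd)) ⟩
    ((λ j → firstPassages e j (suc h) false) ⋆ K) m + ((λ j → downSteps (e j) (λ h′ → firstPassages e j h′ true) h pd) ⋆ K) m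
      ≡⟨ ⋆-distribʳ-+ (λ j → firstPassages e j (suc h) false) (λ j → downSteps (e j) (λ h′ → firstPassages e j h′ true) h pd) K m ⟨
    ((λ j → firstPassages e (suc j) h pd) ⋆ K) m ∎
    where
    open ≡-Reasoning
    e⋆K = λ m d → ((λ j → e j d) ⋆ K) m

  -- Seen one level lower, a walk from height h + 2 reaches the axis either by jumping over
  -- level 1 or by first landing on level 1 and then starting afresh from there.
  firstPassages-lower : ∀ e m h pd →
    firstPassages e m (suc (suc h)) pd ≡ firstPassages (λ m d → e m (suc d) + firstPassages e m 1 true) m (suc h) pd
  firstPassages-lower e zero    h pd = refl
  firstPassages-lower e (suc m) h pd = cong₂ _+_ (firstPassages-lower e m (suc h) false) (downs pd)
    where
    downs : ∀ pd → downSteps (e m) (λ h′ → firstPassages e m h′ true) (suc (suc h)) pd ≡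
                   downSteps (λ d → e m (suc d) + firstPassages e m 1 true)
                             (λ h′ → firstPassages (λ m d → e m (suc d) + firstPassages e m 1 true) m h′ true) (suc h) pd
    downs true  = refl
    downs false = trans (cong (λ s → e m (suc h) + (firstPassages e m 1 true + s))
                              (sum-cong-≗ {h} (λ t → firstPassages-lower e m (toℕ t) true)))
                        (sym (+-assoc (e m (suc h)) _ _))

  walks-firstPassages : ∀ m h pd k → walks m (suc h) pd k ≡ firstPassages (λ m d → afterLanding (paths m) d k) m (suc h) pd
  walks-firstPassages zero    h pd k = refl
  walks-firstPassages (suc m) h pd k =
    cong₂ _+_ (walks-firstPassages m (suc h) false k)
              (downSteps-cong (suc h) pd (λ _ → refl) (λ h′ → walks-firstPassages m h′ true k))

  isZero isPositive : ℕ → ℕ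
  isZero zero        = 1
  isZero (suc _)     = 0
  isPositive zero    = 0
  isPositive (suc _) = 1

  atEnd : (ℕ → ℕ) → ℕ → ℕ → ℕ
  atEnd w zero    d = w d
  atEnd w (suc m) d = 0

  atEnd-⋆ : ∀ w d K m → ((λ j → atEnd w j d) ⋆ K) m ≡ w d * K m
  atEnd-⋆ w d K m = trans (cong (w d * K m +_) (∑-zero {m} _ (λ _ → refl))) (+-identityʳ (w d * K m))

  afterLanding-split : ∀ g d k → afterLanding g d k ≡ isZero d * g k + isPositive d * yShift g k
  afterLanding-split g zero    k = sym (trans (+-identityʳ _) (*-identityˡ (g k)))
  afterLanding-split g (suc d) k = sym (+-identityʳ (yShift g k))

  walks-decomposition : ∀ m h pd k → walks m (suc h) pd k ≡
    ((λ j → firstPassages (atEnd isZero) j (suc h) pd) ⋆ (λ t → paths t k)) m +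
    ((λ j → firstPassages (atEnd isPositive) j (suc h) pd) ⋆ (λ t → yShift (paths t) k)) m
  walks-decomposition m h pd k = begin
    walks m (suc h) pd k
      ≡⟨ walks-firstPassages m h pd k ⟩
    firstPassages (λ m d → afterLanding (paths m) d k) m (suc h) pd
      ≡⟨ firstPassages-cong landing m (suc h) pd ⟩
    firstPassages (λ m d → ((λ j → atEnd isZero j d) ⋆ P) m + ((λ j → atEnd isPositive j d) ⋆ G) m) m (suc h) pd
      ≡⟨ firstPassages-+ (λ m d → ((λ j → atEnd isZero j d) ⋆ P) m) (λ m d → ((λ j → atEnd isPositive j d) ⋆ G) m) m (suc h) pd ⟩
    firstPassages (λ m d → ((λ j → atEnd isZero j d) ⋆ P) m) m (suc h) pd +
    firstPassages (λ m d → ((λ j → atEnd isPositive j d) ⋆ G) m) m (suc h) pd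
      ≡⟨ cong₂ _+_ (firstPassages-⋆ (atEnd isZero) P m (suc h) pd) (firstPassages-⋆ (atEnd isPositive) G m (suc h) pd) ⟩
    ((λ j → firstPassages (atEnd isZero) j (suc h) pd) ⋆ P) m + ((λ j → firstPassages (atEnd isPositive) j (suc h) pd) ⋆ G) m ∎
    where
    open ≡-Reasoning
    P G : ℕ → ℕ
    P t = paths t k
    G t = yShift (paths t) k
    landing : ∀ m d → afterLanding (paths m) d k ≡ ((λ j → atEnd isZero j d) ⋆ P) m + ((λ j → atEnd isPositive j d) ⋆ G) m
    landing m d = trans (afterLanding-split (paths m) d k) (sym (cong₂ _+_ (atEnd-⋆ isZero d P m) (atEnd-⋆ isPositive d G m)))

  mutual
    D₁-passages-high : ∀ m h pd → firstPassages (atEnd isZero) m (suc (suc h)) pd ≡ 0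
    D₁-passages-high zero    h pd    = refl
    D₁-passages-high (suc m) h true  = trans (+-identityʳ _) (D₁-passages-high m (suc h) false)
    D₁-passages-high (suc m) h false =
      cong₂ _+_ (D₁-passages-high m (suc h) false) (cong₂ _+_ (landing m) (∑-zero {suc h} _ (λ t → from-top m (toℕ t))))
      where
      landing : ∀ m → atEnd isZero m (suc h) ≡ 0
      landing zero    = refl
      landing (suc m) = refl
      from-top : ∀ m t → firstPassages (atEnd isZero) m (suc t) true ≡ 0
      from-top m zero    = D₁-passages-top m
      from-top m (suc t) = D₁-passages-high m t true

    D₁-passages-top : ∀ m → firstPassages (atEnd isZero) m 1 true ≡ 0
    D₁-passages-top zero    = refl
    D₁-passages-top (suc m) = trans (+-identityʳ _) (D₁-passages-high m 0 false)

  D₁-passages : ∀ m → firstPassages (atEnd isZero) (suc m) 1 false ≡ isZero m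
  D₁-passages zero    = refl
  D₁-passages (suc m) = trans (+-identityʳ _) (D₁-passages-high (suc m) 0 false)

  D₁-passages-⋆ : ∀ K n → ((λ j → firstPassages (atEnd isZero) j 1 false) ⋆ K) (suc n) ≡ K n
  D₁-passages-⋆ K n = begin
    ((λ j → firstPassages (atEnd isZero) (suc j) 1 false) ⋆ K) n ≡⟨ ⋆-cong {g = K} n D₁-passages (λ _ → refl) ⟩
    (isZero ⋆ K) n                                                ≡⟨ ⋆-headˡ isZero K n (λ _ → refl) ⟩
    1 * K n                                                       ≡⟨ *-identityˡ (K n) ⟩
    K n                                                           ∎
    where open ≡-Reasoning

  passages-split : ∀ j h pd → firstPassages (atEnd (λ _ → 1)) j h pd ≡
                              firstPassages (atEnd isZero) j h pd + firstPassages (atEnd isPositive) j h pd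
  passages-split j h pd = trans (firstPassages-cong split j h pd) (firstPassages-+ (atEnd isZero) (atEnd isPositive) j h pd)
    where
    split : ∀ j d → atEnd (λ _ → 1) j d ≡ atEnd isZero j d + atEnd isPositive j d
    split zero    zero    = refl
    split zero    (suc d) = refl
    split (suc j) d       = refl

  -- An arch is an up-step followed by a first passage from height 1 ending in a catastrophe.
  arches : ℕ → ℕ
  arches zero    = 0
  arches (suc t) = firstPassages (atEnd isPositive) t 1 false

  arches-from-top : ∀ t → firstPassages (atEnd isPositive) t 1 true ≡ arches (suc t)
  arches-from-top zero          = refl
  arches-from-top (suc zero)    = refl
  arches-from-top (suc (suc t)) = refl

  paths-rec : ∀ n k → paths (suc (suc n)) k ≡ paths n k + (arches ⋆ (λ t → yShift (paths t) k)) (suc (suc n))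
  paths-rec n k = begin
    walks (suc n) 1 false k + 0  ≡⟨ +-identityʳ _ ⟩
    walks (suc n) 1 false k      ≡⟨ walks-decomposition (suc n) 0 false k ⟩
    ((λ j → firstPassages (atEnd isZero) j 1 false) ⋆ (λ t → paths t k)) (suc n) + (arches ⋆ (λ t → yShift (paths t) k)) (suc (suc n))
                                 ≡⟨ cong (_+ (arches ⋆ (λ t → yShift (paths t) k)) (suc (suc n))) (D₁-passages-⋆ (λ t → paths t k) n) ⟩
    paths n k + (arches ⋆ (λ t → yShift (paths t) k)) (suc (suc n)) ∎
    where open ≡-Reasoning

  arches-rec : ∀ m → arches (3 + m) ≡ isZero m + arches (2 + m) + arches (1 + m) + (arches ⋆ arches) (3 + m)
  arches-rec m = begin
    firstPassages e₂ (suc m) 2 false + 0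
      ≡⟨ +-identityʳ _ ⟩
    firstPassages e₂ (suc m) 2 false
      ≡⟨ firstPassages-lower e₂ (suc m) 0 false ⟩
    firstPassages (λ j d → e₂ j (suc d) + firstPassages e₂ j 1 true) (suc m) 1 false
      ≡⟨ firstPassages-cong landing (suc m) 1 false ⟩
    firstPassages (λ j d → e j d + ((λ i → e i d) ⋆ A) j) (suc m) 1 false
      ≡⟨ firstPassages-+ e (λ j d → ((λ i → e i d) ⋆ A) j) (suc m) 1 false ⟩
    firstPassages e (suc m) 1 false + firstPassages (λ j d → ((λ i → e i d) ⋆ A) j) (suc m) 1 false
      ≡⟨ cong₂ _+_ (passages-split (suc m) 1 false) (firstPassages-⋆ e A (suc m) 1 false) ⟩
    (firstPassages e₁ (suc m) 1 false + arches (2 + m)) + ((λ j → firstPassages e j 1 false) ⋆ A) (suc m)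
      ≡⟨ cong₂ _+_ (cong (_+ arches (2 + m)) (D₁-passages m))
                   (trans (⋆-cong {g = A} (suc m) (λ j → passages-split j 1 false) (λ _ → refl))
                          (⋆-distribʳ-+ (λ j → firstPassages e₁ j 1 false) A A (suc m))) ⟩
    (isZero m + arches (2 + m)) + (((λ j → firstPassages e₁ j 1 false) ⋆ A) (suc m) + (A ⋆ A) (suc m))
      ≡⟨ cong₂ (λ x y → (isZero m + arches (2 + m)) + (x + y)) (D₁-passages-⋆ A m) (sym (⋆-comm A arches (2 + m))) ⟩
    (isZero m + arches (2 + m)) + (arches (1 + m) + (arches ⋆ arches) (3 + m))
      ≡⟨ +-assoc (isZero m + arches (2 + m)) _ _ ⟨
    isZero m + arches (2 + m) + arches (1 + m) + (arches ⋆ arches) (3 + m) ∎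
    where
    open ≡-Reasoning
    e e₁ e₂ : ℕ → ℕ → ℕ
    e  = atEnd (λ _ → 1)
    e₁ = atEnd isZero
    e₂ = atEnd isPositive
    A : ℕ → ℕ
    A t = arches (suc t)
    landing : ∀ j d → e₂ j (suc d) + firstPassages e₂ j 1 true ≡ e j d + ((λ i → e i d) ⋆ A) j
    landing j d = cong₂ _+_ (lands j) (trans (arches-from-top j) (sym (trans (atEnd-⋆ (λ _ → 1) d A j) (*-identityˡ (A j)))))
      where
      lands : ∀ j → e₂ j (suc d) ≡ e j d
      lands zero    = refl
      lands (suc j) = refl


open import Data.Nat as ℕ using (ℕ; zero; suc; _∸_)
import Data.Nat.Properties as ℕ
open import Data.Nat.Induction using (<-rec)
open import Data.Fin as Fin using (Fin; toℕ)
open import Data.Fin.Properties using (toℕ<n)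
open import Data.List using (applyUpTo)
import Data.Integer as ℤ
import Data.Integer.Properties as ℤ
import Data.Nat.Coprimality as Coprime
open import Data.Rational using (ℚ; 0ℚ; ½; _+_; _*_; -_; _-_; mkℚ; _/_)
open import Data.Rational.Properties
open import Data.Rational.Solver using (module +-*-Solver)
open import Relation.Binary.PropositionalEquality

open Walks using (arches; arches-rec; isZero; paths; paths-rec; yShift; c-paths)
module ℕ⋆ = Convolution ℕ.+-*-commutativeSemiring
open Convolution (CommutativeRing.commutativeSemiring +-*-commutativeRing)
open +-*-Solver

-- ℕtoℚ n goes through normalize, so ℚ arithmetic on it only computes after this rewrite.
ℕtoℚ-mkℚ : ∀ n → ℕtoℚ n ≡ mkℚ (ℤ.+ n) 0 (Coprime.sym (Coprime.1-coprimeTo n))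
ℕtoℚ-mkℚ n = normalize-coprime (Coprime.sym (Coprime.1-coprimeTo n))

ℕtoℚ-+ : ∀ a b → ℕtoℚ (a ℕ.+ b) ≡ ℕtoℚ a + ℕtoℚ b
ℕtoℚ-+ a b rewrite ℕtoℚ-mkℚ a | ℕtoℚ-mkℚ b = cong (_/ 1) (sym (cong₂ ℤ._+_ (ℤ.*-identityʳ (ℤ.+ a)) (ℤ.*-identityʳ (ℤ.+ b))))

ℕtoℚ-* : ∀ a b → ℕtoℚ (a ℕ.* b) ≡ ℕtoℚ a * ℕtoℚ b
ℕtoℚ-* a b rewrite ℕtoℚ-mkℚ a | ℕtoℚ-mkℚ b = cong (_/ 1) (ℤ.pos-* a b)

ℕtoℚ-∑ : ∀ n (f : Fin n → ℕ) → ℕtoℚ (ℕ⋆.sum f) ≡ sum (λ i → ℕtoℚ (f i))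
ℕtoℚ-∑ zero    f = refl
ℕtoℚ-∑ (suc n) f = trans (ℕtoℚ-+ (f Fin.zero) (ℕ⋆.sum (λ i → f (Fin.suc i))))
                         (cong (ℕtoℚ (f Fin.zero) +_) (ℕtoℚ-∑ n (λ i → f (Fin.suc i))))

ℕtoℚ-⋆ : ∀ f g n → ℕtoℚ ((f ℕ⋆.⋆ g) n) ≡ ((λ i → ℕtoℚ (f i)) ⋆ (λ i → ℕtoℚ (g i))) n
ℕtoℚ-⋆ f g n = trans (ℕtoℚ-∑ (suc n) (λ i → f (toℕ i) ℕ.* g (n ∸ toℕ i)))
                     (sum-cong-≗ {suc n} (λ i → ℕtoℚ-* (f (toℕ i)) (g (n ∸ toℕ i))))

sumℚ-applyUpTo : ∀ n (f : ℕ → ℚ) → sumℚ (applyUpTo f n) ≡ ∑[ i < n ] f (toℕ i)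
sumℚ-applyUpTo zero    f = refl
sumℚ-applyUpTo (suc n) f = cong (f 0 +_) (sumℚ-applyUpTo n (λ i → f (suc i)))

col : FPS → ℕ → ℕ → ℚ
col f k n = f n k

·ₛ-columns : ∀ f g n k → (f ·ₛ g) n k ≡ ∑[ j ≤ k ] (col f (toℕ j) ⋆ col g (k ∸ toℕ j)) n
·ₛ-columns f g n k = begin
  (f ·ₛ g) n k
    ≡⟨ sumℚ-applyUpTo (suc n) (λ i → sumℚ (applyUpTo (λ j → f i j * g (n ∸ i) (k ∸ j)) (suc k))) ⟩
  ∑[ i ≤ n ] sumℚ (applyUpTo (λ j → f (toℕ i) j * g (n ∸ toℕ i) (k ∸ j)) (suc k))
    ≡⟨ sum-cong-≗ {suc n} (λ i → sumℚ-applyUpTo (suc k) (λ j → f (toℕ i) j * g (n ∸ toℕ i) (k ∸ j))) ⟩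
  ∑[ i ≤ n ] ∑[ j ≤ k ] (f (toℕ i) (toℕ j) * g (n ∸ toℕ i) (k ∸ toℕ j))
    ≡⟨ ∑-comm {suc n} {suc k} (λ i j → f (toℕ i) (toℕ j) * g (n ∸ toℕ i) (k ∸ toℕ j)) ⟩
  ∑[ j ≤ k ] (col f (toℕ j) ⋆ col g (k ∸ toℕ j)) n ∎
  where open ≡-Reasoning

constₛ-· : ∀ a g n k → (constₛ a ·ₛ g) n k ≡ a * g n k
constₛ-· a g n k = begin
  (constₛ a ·ₛ g) n k
    ≡⟨ ·ₛ-columns (constₛ a) g n k ⟩
  (col (constₛ a) 0 ⋆ col g k) n + ∑[ j < k ] (col (constₛ a) (suc (toℕ j)) ⋆ col g (k ∸ suc (toℕ j))) n
    ≡⟨ cong₂ _+_ (⋆-headˡ (col (constₛ a) 0) (col g k) n (λ _ → refl))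
                 (∑-zero {k} _ (λ j → ⋆-zeroˡ (col (constₛ a) (suc (toℕ j))) (col g (k ∸ suc (toℕ j))) n constₛ-off)) ⟩
  a * g n k + 0ℚ
    ≡⟨ +-identityʳ (a * g n k) ⟩
  a * g n k ∎
  where
  open ≡-Reasoning
  constₛ-off : ∀ {j} i → constₛ a i (suc j) ≡ 0ℚ
  constₛ-off zero    = refl
  constₛ-off (suc i) = refl

Y-column-zero : ∀ i → Y i 0 ≡ 0ℚ
Y-column-zero zero    = refl
Y-column-zero (suc i) = refl

Y-column-high : ∀ j i → Y i (2 ℕ.+ j) ≡ 0ℚ
Y-column-high j zero    = refl
Y-column-high j (suc i) = refl

Y-·-zero : ∀ h n → (Y ·ₛ h) n 0 ≡ 0ℚ
Y-·-zero h n = trans (·ₛ-columns Y h n 0) (cong (_+ 0ℚ) (⋆-zeroˡ (col Y 0) (col h 0) n Y-column-zero))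

Y-·-suc : ∀ h n k → (Y ·ₛ h) n (suc k) ≡ h n k
Y-·-suc h n k = begin
  (Y ·ₛ h) n (suc k)
    ≡⟨ ·ₛ-columns Y h n (suc k) ⟩
  (col Y 0 ⋆ col h (suc k)) n + ((col Y 1 ⋆ col h k) n + ∑[ j < k ] (col Y (2 ℕ.+ toℕ j) ⋆ col h (k ∸ suc (toℕ j))) n)
    ≡⟨ cong₂ _+_ (⋆-zeroˡ (col Y 0) (col h (suc k)) n Y-column-zero)
                 (cong₂ _+_ (⋆-headˡ (col Y 1) (col h k) n (λ _ → refl)) (∑-zero {k} _ high)) ⟩
  0ℚ + (1ℚ * h n k + 0ℚ)
    ≡⟨ trans (+-identityˡ _) (trans (+-identityʳ _) (*-identityˡ (h n k))) ⟩
  h n k ∎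
  where
  open ≡-Reasoning
  high : ∀ (j : Fin k) → (col Y (2 ℕ.+ toℕ j) ⋆ col h (k ∸ suc (toℕ j))) n ≡ 0ℚ
  high j = ⋆-zeroˡ (col Y (2 ℕ.+ toℕ j)) (col h (k ∸ suc (toℕ j))) n (Y-column-high (toℕ j))

·ₛ-column-zero : ∀ f g n → (f ·ₛ g) n 0 ≡ (col f 0 ⋆ col g 0) n
·ₛ-column-zero f g n = trans (·ₛ-columns f g n 0) (+-identityʳ _)

·ₛ-column-suc : ∀ f g → (∀ k n → g n (2 ℕ.+ k) ≡ 0ℚ) →
                ∀ n k → (f ·ₛ g) n (suc k) ≡ (col f k ⋆ col g 1) n + (col f (suc k) ⋆ col g 0) n
·ₛ-column-suc f g g-linear n k = begin
  (f ·ₛ g) n (suc k)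
    ≡⟨ ·ₛ-columns f g n (suc k) ⟩
  ∑[ j ≤ suc k ] (col f (toℕ j) ⋆ col g (suc k ∸ toℕ j)) n
    ≡⟨ ∑≤-last (suc k) (λ j → (col f j ⋆ col g (suc k ∸ j)) n) ⟩
  ∑[ j ≤ k ] (col f (toℕ j) ⋆ col g (suc k ∸ toℕ j)) n + (col f (suc k) ⋆ col g (suc k ∸ suc k)) n
    ≡⟨ cong₂ _+_ (∑≤-last k (λ j → (col f j ⋆ col g (suc k ∸ j)) n)) (cong (λ j → (col f (suc k) ⋆ col g j) n) (ℕ.n∸n≡0 k)) ⟩
  (∑[ j < k ] (col f (toℕ j) ⋆ col g (suc k ∸ toℕ j)) n + (col f k ⋆ col g (suc k ∸ k)) n) + (col f (suc k) ⋆ col g 0) n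
    ≡⟨ cong (λ s → (s + (col f k ⋆ col g (suc k ∸ k)) n) + (col f (suc k) ⋆ col g 0) n) (∑-zero {k} _ high) ⟩
  (0ℚ + (col f k ⋆ col g (suc k ∸ k)) n) + (col f (suc k) ⋆ col g 0) n
    ≡⟨ cong (λ j → (0ℚ + (col f k ⋆ col g j) n) + (col f (suc k) ⋆ col g 0) n) (ℕ.m+n∸n≡m 1 k) ⟩
  (0ℚ + (col f k ⋆ col g 1) n) + (col f (suc k) ⋆ col g 0) n
    ≡⟨ cong (_+ (col f (suc k) ⋆ col g 0) n) (+-identityˡ ((col f k ⋆ col g 1) n)) ⟩
  (col f k ⋆ col g 1) n + (col f (suc k) ⋆ col g 0) n ∎
  where
  open ≡-Reasoning
  high : ∀ (j : Fin k) → (col f (toℕ j) ⋆ col g (suc k ∸ toℕ j)) n ≡ 0ℚ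
  high j rewrite ℕ.+-∸-assoc 1 (ℕ.<⇒≤ (toℕ<n j)) | ℕ.+-∸-assoc 1 (toℕ<n j) =
    trans (⋆-comm (col f (toℕ j)) (col g (2 ℕ.+ r)) n) (⋆-zeroˡ (col g (2 ℕ.+ r)) (col f (toℕ j)) n (g-linear r))
    where r = k ∸ suc (toℕ j)

⋆-square-injective : ∀ f g → f 0 ≡ 1ℚ → g 0 ≡ 1ℚ → (∀ n → (f ⋆ f) n ≡ (g ⋆ g) n) → ∀ n → f n ≡ g n
⋆-square-injective f g f₀≡1 g₀≡1 f²≡g² n =
  trans (solve 2 (λ x y → x := (x :+ con (- 1ℚ) :* y) :+ y) refl (f n) (g n))
        (trans (cong (_+ g n) (⋆-cancelˡ {½} f+g f-g ½*2≡1 product≡0 n)) (+-identityˡ (g n)))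
  where
  open ≡-Reasoning
  f+g f-g : ℕ → ℚ
  f+g i = f i + 1ℚ * g i
  f-g i = f i + - 1ℚ * g i
  ½*2≡1 : ½ * f+g 0 ≡ 1ℚ
  ½*2≡1 rewrite f₀≡1 | g₀≡1 = refl
  product≡0 : ∀ n → (f+g ⋆ f-g) n ≡ 0ℚ
  product≡0 n = begin
    (f+g ⋆ f-g) n
      ≡⟨ ⋆-comm f+g f-g n ⟩
    (f-g ⋆ f+g) n
      ≡⟨ ⋆-affineˡ f (- 1ℚ) g f+g n ⟩
    (f ⋆ f+g) n + - 1ℚ * (g ⋆ f+g) n
      ≡⟨ cong₂ (λ x y → x + - 1ℚ * y) (⋆-comm f f+g n) (⋆-comm g f+g n) ⟩
    (f+g ⋆ f) n + - 1ℚ * (f+g ⋆ g) n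
      ≡⟨ cong₂ (λ x y → x + - 1ℚ * y) (⋆-affineˡ f 1ℚ g f n) (⋆-affineˡ f 1ℚ g g n) ⟩
    ((f ⋆ f) n + 1ℚ * (g ⋆ f) n) + - 1ℚ * ((f ⋆ g) n + 1ℚ * (g ⋆ g) n)
      ≡⟨ cong₂ (λ x y → (x + 1ℚ * y) + - 1ℚ * ((f ⋆ g) n + 1ℚ * (g ⋆ g) n)) (f²≡g² n) (⋆-comm g f n) ⟩
    ((g ⋆ g) n + 1ℚ * (f ⋆ g) n) + - 1ℚ * ((f ⋆ g) n + 1ℚ * (g ⋆ g) n)
      ≡⟨ solve 2 (λ a b → (a :+ con 1ℚ :* b) :+ con (- 1ℚ) :* (b :+ con 1ℚ :* a) := con 0ℚ) refl ((g ⋆ g) n) ((f ⋆ g) n) ⟩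
    0ℚ ∎

two four : ℚ
two  = ℕtoℚ 2
four = ℕtoℚ 4

1-x-x² x³ radicand₀ 2-2x² : ℕ → ℚ
1-x-x² 0 = 1ℚ
1-x-x² 1 = - 1ℚ
1-x-x² 2 = - 1ℚ
1-x-x² _ = 0ℚ

x³ 3 = 1ℚ
x³ _ = 0ℚ

radicand₀ 0 = 1ℚ
radicand₀ 1 = - two
radicand₀ 2 = - 1ℚ
radicand₀ 3 = - two
radicand₀ 4 = 1ℚ
radicand₀ _ = 0ℚ

2-2x² 0 = two
2-2x² 2 = - two
2-2x² _ = 0ℚ

radicand-expand : ∀ n k → radicand n k ≡
  (((mono 4 0 n k - two * mono 3 0 n k) - mono 2 0 n k) - two * X n k) + constₛ 1ℚ n k
radicand-expand n k =
  cong₂ (λ a b → (((mono 4 0 n k - a) - mono 2 0 n k) - b) + constₛ 1ℚ n k) (constₛ-· two (mono 3 0) n k) (constₛ-· two X n k)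

radicand-column-zero : ∀ n → radicand n 0 ≡ radicand₀ n
radicand-column-zero n = trans (radicand-expand n 0) (evaluate n)
  where
  evaluate : ∀ n → (((mono 4 0 n 0 - two * mono 3 0 n 0) - mono 2 0 n 0) - two * X n 0) + constₛ 1ℚ n 0 ≡ radicand₀ n
  evaluate 0 = refl
  evaluate 1 = refl
  evaluate 2 = refl
  evaluate 3 = refl
  evaluate 4 = refl
  evaluate (suc (suc (suc (suc (suc n))))) = refl

radicand-column-suc : ∀ n k → radicand n (suc k) ≡ 0ℚ
radicand-column-suc n k = trans (radicand-expand n (suc k)) (evaluate n)
  where
  evaluate : ∀ n → (((mono 4 0 n (suc k) - two * mono 3 0 n (suc k)) - mono 2 0 n (suc k)) - two * X n (suc k)) + constₛ 1ℚ n (suc k) ≡ 0ℚ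
  evaluate 0 = refl
  evaluate 1 = refl
  evaluate 2 = refl
  evaluate 3 = refl
  evaluate 4 = refl
  evaluate (suc (suc (suc (suc (suc n))))) = refl

1-x-x²-squared : ∀ n → (1-x-x² ⋆ 1-x-x²) n - four * x³ n ≡ radicand₀ n
1-x-x²-squared 0 = refl
1-x-x²-squared 1 = refl
1-x-x²-squared (suc (suc m)) = trans (cong (_- four * x³ (2 ℕ.+ m)) (⋆-degree≤2ˡ 1-x-x² 1-x-x² m (λ _ → refl))) (evaluate m)
  where
  evaluate : ∀ m → (1ℚ * 1-x-x² (2 ℕ.+ m) + (- 1ℚ * 1-x-x² (1 ℕ.+ m) + - 1ℚ * 1-x-x² m)) - four * x³ (2 ℕ.+ m) ≡ radicand₀ (2 ℕ.+ m)
  evaluate 0 = refl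
  evaluate 1 = refl
  evaluate 2 = refl
  evaluate (suc (suc (suc m))) = refl

archesℚ : ℕ → ℚ
archesℚ n = ℕtoℚ (arches n)


archesℚ-quadratic : ∀ n → (archesℚ ⋆ archesℚ) n + x³ n ≡ (1-x-x² ⋆ archesℚ) n
archesℚ-quadratic 0 = refl
archesℚ-quadratic 1 = refl
archesℚ-quadratic 2 = refl
archesℚ-quadratic (suc (suc (suc m))) = begin
  (archesℚ ⋆ archesℚ) (3 ℕ.+ m) + x³ (3 ℕ.+ m)
    ≡⟨ cong₂ _+_ (sym (ℕtoℚ-⋆ arches arches (3 ℕ.+ m))) (sym (isZero-x³ m)) ⟩
  C + ℕtoℚ (isZero m)
    ≡⟨ solve 4 (λ c z b a → c :+ z := (z :+ b :+ a :+ c) :+ (con (- 1ℚ) :* b :+ con (- 1ℚ) :* a)) refl C (ℕtoℚ (isZero m)) A₂ A₁ ⟩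
  (ℕtoℚ (isZero m) + A₂ + A₁ + C) + (- 1ℚ * A₂ + - 1ℚ * A₁)
    ≡⟨ cong (_+ (- 1ℚ * A₂ + - 1ℚ * A₁)) (sym recurrence) ⟩
  archesℚ (3 ℕ.+ m) + (- 1ℚ * A₂ + - 1ℚ * A₁)
    ≡⟨ cong (_+ (- 1ℚ * A₂ + - 1ℚ * A₁)) (sym (*-identityˡ (archesℚ (3 ℕ.+ m)))) ⟩
  1ℚ * archesℚ (3 ℕ.+ m) + (- 1ℚ * A₂ + - 1ℚ * A₁)
    ≡⟨ sym (⋆-degree≤2ˡ 1-x-x² archesℚ (suc m) (λ _ → refl)) ⟩
  (1-x-x² ⋆ archesℚ) (3 ℕ.+ m) ∎
  where
  open ≡-Reasoning
  A₁ = archesℚ (1 ℕ.+ m)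
  A₂ = archesℚ (2 ℕ.+ m)
  C = ℕtoℚ ((arches ℕ⋆.⋆ arches) (3 ℕ.+ m))
  isZero-x³ : ∀ m → ℕtoℚ (isZero m) ≡ x³ (3 ℕ.+ m)
  isZero-x³ zero    = refl
  isZero-x³ (suc m) = refl
  recurrence : archesℚ (3 ℕ.+ m) ≡ ℕtoℚ (isZero m) + A₂ + A₁ + C
  recurrence = trans (cong ℕtoℚ (arches-rec m))
    (trans (ℕtoℚ-+ (isZero m ℕ.+ arches (2 ℕ.+ m) ℕ.+ arches (1 ℕ.+ m)) _)
    (cong (_+ C) (trans (ℕtoℚ-+ (isZero m ℕ.+ arches (2 ℕ.+ m)) (arches (1 ℕ.+ m)))
    (cong (_+ A₁) (ℕtoℚ-+ (isZero m) (arches (2 ℕ.+ m)))))))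

√radicand : ℕ → ℚ
√radicand n = 1-x-x² n + - two * archesℚ n

√radicand-squared : ∀ n → (√radicand ⋆ √radicand) n ≡ radicand₀ n
√radicand-squared n = begin
  (√radicand ⋆ √radicand) n
    ≡⟨ ⋆-affineˡ 1-x-x² (- two) archesℚ √radicand n ⟩
  (1-x-x² ⋆ √radicand) n + - two * (archesℚ ⋆ √radicand) n
    ≡⟨ cong₂ (λ x y → x + - two * y) (⋆-comm 1-x-x² √radicand n) (⋆-comm archesℚ √radicand n) ⟩
  (√radicand ⋆ 1-x-x²) n + - two * (√radicand ⋆ archesℚ) n
    ≡⟨ cong₂ (λ x y → x + - two * y) (⋆-affineˡ 1-x-x² (- two) archesℚ 1-x-x² n) (⋆-affineˡ 1-x-x² (- two) archesℚ archesℚ n) ⟩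
  (UU + - two * (archesℚ ⋆ 1-x-x²) n) + - two * (UA + - two * AA)
    ≡⟨ cong (λ x → (UU + - two * x) + - two * (UA + - two * AA)) (⋆-comm archesℚ 1-x-x² n) ⟩
  (UU + - two * UA) + - two * (UA + - two * AA)
    ≡⟨ cong (λ x → (UU + - two * x) + - two * (x + - two * AA)) (sym (archesℚ-quadratic n)) ⟩
  (UU + - two * (AA + x³ n)) + - two * ((AA + x³ n) + - two * AA)
    ≡⟨ solve 3 (λ uu aa c → (uu :+ con (- two) :* (aa :+ c)) :+ con (- two) :* ((aa :+ c) :+ con (- two) :* aa)
                            := uu :- con four :* c) refl UU AA (x³ n) ⟩
  UU - four * x³ n
    ≡⟨ 1-x-x²-squared n ⟩
  radicand₀ n ∎
  where
  open ≡-Reasoning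
  UU = (1-x-x² ⋆ 1-x-x²) n
  UA = (1-x-x² ⋆ archesℚ) n
  AA = (archesℚ ⋆ archesℚ) n

pathsℚ : ℕ → ℕ → ℚ
pathsℚ k n = ℕtoℚ (paths n k)

Cgf+1-paths : ∀ n k → (Cgf +ₛ constₛ 1ℚ) n k ≡ pathsℚ k n
Cgf+1-paths zero    zero    = refl
Cgf+1-paths zero    (suc k) = refl
Cgf+1-paths (suc m) k       = trans (+-identityʳ (ℕtoℚ (c (suc m) k))) (cong ℕtoℚ (c-paths m k))

paths-equation : ∀ k n → (2-2x² ⋆ pathsℚ k) n ≡ two * (constₛ 1ℚ n k + ℕtoℚ ((arches ℕ⋆.⋆ (λ t → yShift (paths t) k)) n))
paths-equation zero    0 = refl
paths-equation (suc k) 0 = refl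
paths-equation zero    1 = refl
paths-equation (suc k) 1 = refl
paths-equation k (suc (suc m)) = begin
  (2-2x² ⋆ pathsℚ k) (2 ℕ.+ m)
    ≡⟨ ⋆-degree≤2ˡ 2-2x² (pathsℚ k) m (λ _ → refl) ⟩
  two * pathsℚ k (2 ℕ.+ m) + (0ℚ * pathsℚ k (1 ℕ.+ m) + - two * pathsℚ k m)
    ≡⟨ cong (λ p → two * p + (0ℚ * pathsℚ k (1 ℕ.+ m) + - two * pathsℚ k m)) (trans (cong ℕtoℚ (paths-rec m k)) (ℕtoℚ-+ (paths m k) _)) ⟩
  two * (pathsℚ k m + C) + (0ℚ * pathsℚ k (1 ℕ.+ m) + - two * pathsℚ k m)
    ≡⟨ solve 3 (λ p q c → con two :* (p :+ c) :+ (con 0ℚ :* q :+ con (- two) :* p) := con two :* (con 0ℚ :+ c))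
               refl (pathsℚ k m) (pathsℚ k (1 ℕ.+ m)) C ⟩
  two * (0ℚ + C) ∎
  where
  open ≡-Reasoning
  C = ℕtoℚ ((arches ℕ⋆.⋆ (λ t → yShift (paths t) k)) (2 ℕ.+ m))

paths-equation-zero : ∀ n → (2-2x² ⋆ pathsℚ 0) n ≡ constₛ two n 0
paths-equation-zero n = trans (paths-equation 0 n) (trans (cong (λ a → two * (constₛ 1ℚ n 0 + ℕtoℚ a)) no-catastrophe) (evaluate n))
  where
  no-catastrophe : (arches ℕ⋆.⋆ (λ t → yShift (paths t) 0)) n ≡ 0
  no-catastrophe = ℕ⋆.∑-zero {suc n} _ (λ i → ℕ.*-zeroʳ (arches (toℕ i)))
  evaluate : ∀ n → two * (constₛ 1ℚ n 0 + 0ℚ) ≡ constₛ two n 0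
  evaluate zero    = refl
  evaluate (suc n) = refl

paths-equation-suc : ∀ k n → (pathsℚ k ⋆ (λ i → - two * archesℚ i)) n + (pathsℚ (suc k) ⋆ 2-2x²) n ≡ constₛ two n (suc k)
paths-equation-suc k n = begin
  (pathsℚ k ⋆ (λ i → - two * archesℚ i)) n + (pathsℚ (suc k) ⋆ 2-2x²) n
    ≡⟨ cong₂ _+_ (trans (⋆-comm (pathsℚ k) (λ i → - two * archesℚ i) n) (⋆-scaleˡ (- two) archesℚ (pathsℚ k) n))
                 (⋆-comm (pathsℚ (suc k)) 2-2x² n) ⟩
  - two * (archesℚ ⋆ pathsℚ k) n + (2-2x² ⋆ pathsℚ (suc k)) n
    ≡⟨ cong₂ (λ a b → - two * a + b) (sym (ℕtoℚ-⋆ arches (λ t → paths t k) n)) (paths-equation (suc k) n) ⟩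
  - two * C + two * (constₛ 1ℚ n (suc k) + C)
    ≡⟨ evaluate n ⟩
  constₛ two n (suc k) ∎
  where
  open ≡-Reasoning
  C = ℕtoℚ ((arches ℕ⋆.⋆ (λ t → paths t k)) n)
  cancel : - two * C + two * (0ℚ + C) ≡ 0ℚ
  cancel = solve 1 (λ c → con (- two) :* c :+ con two :* (con 0ℚ :+ c) := con 0ℚ) refl C
  evaluate : ∀ n → - two * C + two * (constₛ 1ℚ n (suc k) + C) ≡ constₛ two n (suc k)
  evaluate zero    = cancel
  evaluate (suc n) = cancel

2-2x²-column : ∀ n → constₛ two n 0 - two * mono 2 0 n 0 ≡ 2-2x² n
2-2x²-column 0 = refl
2-2x²-column 1 = refl
2-2x²-column 2 = refl
2-2x²-column (suc (suc (suc n))) = refl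

2-2x²-column-suc : ∀ n k → constₛ two n (suc k) - two * mono 2 0 n (suc k) ≡ 0ℚ
2-2x²-column-suc 0 k = refl
2-2x²-column-suc 1 k = refl
2-2x²-column-suc 2 k = refl
2-2x²-column-suc (suc (suc (suc n))) k = refl

1-x-x²-column : ∀ n → (constₛ 1ℚ n 0 - X n 0) - mono 2 0 n 0 ≡ 1-x-x² n
1-x-x²-column 0 = refl
1-x-x²-column 1 = refl
1-x-x²-column 2 = refl
1-x-x²-column (suc (suc (suc n))) = refl

1-x-x²-column-suc : ∀ n k → (constₛ 1ℚ n (suc k) - X n (suc k)) - mono 2 0 n (suc k) ≡ 0ℚ
1-x-x²-column-suc 0 k = refl
1-x-x²-column-suc 1 k = refl
1-x-x²-column-suc 2 k = refl
1-x-x²-column-suc (suc (suc (suc n))) k = refl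

denom-expand : ∀ S n k → denom S n k ≡
  (constₛ two n k - two * mono 2 0 n k) - (Y ·ₛ (((constₛ 1ℚ -ₛ X) -ₛ mono 2 0) -ₛ S)) n k
denom-expand S n k = cong (λ a → (constₛ two n k - a) - (Y ·ₛ (((constₛ 1ℚ -ₛ X) -ₛ mono 2 0) -ₛ S)) n k) (constₛ-· two (mono 2 0) n k)

module SquareRoot (S : FPS) (S₀₀≡1 : S 0 0 ≡ 1ℚ) (S²≡radicand : S ·ₛ S ≈ₛ radicand) where

  column-zero : ∀ n → S n 0 ≡ √radicand n
  column-zero = ⋆-square-injective (col S 0) √radicand S₀₀≡1 refl squares
    where
    squares : ∀ n → (col S 0 ⋆ col S 0) n ≡ (√radicand ⋆ √radicand) n
    squares n = begin
      (col S 0 ⋆ col S 0) n      ≡⟨ +-identityʳ ((col S 0 ⋆ col S 0) n) ⟨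
      (col S 0 ⋆ col S 0) n + 0ℚ ≡⟨ ·ₛ-columns S S n 0 ⟨
      (S ·ₛ S) n 0               ≡⟨ S²≡radicand n 0 ⟩
      radicand n 0               ≡⟨ radicand-column-zero n ⟩
      radicand₀ n                ≡⟨ √radicand-squared n ⟨
      (√radicand ⋆ √radicand) n  ∎
      where open ≡-Reasoning

  column-suc : ∀ k n → S n (suc k) ≡ 0ℚ
  column-suc = <-rec (λ k → ∀ n → S n (suc k) ≡ 0ℚ) step
    where
    step : ∀ k → (∀ {j} → j ℕ.< k → ∀ n → S n (suc j) ≡ 0ℚ) → ∀ n → S n (suc k) ≡ 0ℚ
    step k below = ⋆-cancelˡ {½} 2√radicand (col S (suc k)) refl doubled
      where
      2√radicand : ℕ → ℚ
      2√radicand i = √radicand i + 1ℚ * √radicand i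
      doubled : ∀ n → (2√radicand ⋆ col S (suc k)) n ≡ 0ℚ
      doubled n = begin
        (2√radicand ⋆ col S (suc k)) n
          ≡⟨ ⋆-affineˡ √radicand 1ℚ √radicand (col S (suc k)) n ⟩
        (√radicand ⋆ col S (suc k)) n + 1ℚ * (√radicand ⋆ col S (suc k)) n
          ≡⟨ cong₂ _+_ (⋆-cong {√radicand} {col S 0} {col S (suc k)} n (λ i → sym (column-zero i)) (λ _ → refl))
                       (trans (*-identityˡ ((√radicand ⋆ col S (suc k)) n)) (⋆-comm √radicand (col S (suc k)) n)) ⟩
        (col S 0 ⋆ col S (suc k)) n + (col S (suc k) ⋆ √radicand) n
          ≡⟨ cong ((col S 0 ⋆ col S (suc k)) n +_)
                  (trans (sym (+-identityˡ ((col S (suc k) ⋆ √radicand) n)))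
                         (cong₂ _+_ (sym middle≡0) (⋆-cong {col S (suc k)} {col S (suc k)} {√radicand} n (λ _ → refl) last))) ⟩
        (col S 0 ⋆ col S (suc k)) n + (∑[ j < k ] (col S (suc (toℕ j)) ⋆ col S (k ∸ toℕ j)) n + (col S (suc k) ⋆ col S (k ∸ k)) n)
          ≡⟨ cong ((col S 0 ⋆ col S (suc k)) n +_) (∑≤-last k (λ j → (col S (suc j) ⋆ col S (k ∸ j)) n)) ⟨
        (col S 0 ⋆ col S (suc k)) n + ∑[ j ≤ k ] (col S (suc (toℕ j)) ⋆ col S (k ∸ toℕ j)) n
          ≡⟨ ·ₛ-columns S S n (suc k) ⟨
        (S ·ₛ S) n (suc k)
          ≡⟨ S²≡radicand n (suc k) ⟩
        radicand n (suc k)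
          ≡⟨ radicand-column-suc n k ⟩
        0ℚ ∎
        where
        open ≡-Reasoning
        middle≡0 : ∑[ j < k ] (col S (suc (toℕ j)) ⋆ col S (k ∸ toℕ j)) n ≡ 0ℚ
        middle≡0 = ∑-zero {k} _ (λ j → ⋆-zeroˡ (col S (suc (toℕ j))) (col S (k ∸ toℕ j)) n (below (toℕ<n j)))
        last : ∀ i → √radicand i ≡ col S (k ∸ k) i
        last i rewrite ℕ.n∸n≡0 k = sym (column-zero i)

  denom-column-zero : ∀ n → denom S n 0 ≡ 2-2x² n
  denom-column-zero n = trans (denom-expand S n 0)
    (trans (cong₂ _-_ (2-2x²-column n) (Y-·-zero (((constₛ 1ℚ -ₛ X) -ₛ mono 2 0) -ₛ S) n)) (+-identityʳ (2-2x² n)))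

  denom-column-one : ∀ n → denom S n 1 ≡ - two * archesℚ n
  denom-column-one n = begin
    denom S n 1
      ≡⟨ denom-expand S n 1 ⟩
    (constₛ two n 1 - two * mono 2 0 n 1) - (Y ·ₛ (((constₛ 1ℚ -ₛ X) -ₛ mono 2 0) -ₛ S)) n 1
      ≡⟨ cong₂ _-_ (2-2x²-column-suc n 0) (Y-·-suc (((constₛ 1ℚ -ₛ X) -ₛ mono 2 0) -ₛ S) n 0) ⟩
    0ℚ - (((constₛ 1ℚ n 0 - X n 0) - mono 2 0 n 0) - S n 0)
      ≡⟨ cong₂ (λ a b → 0ℚ - (a - b)) (1-x-x²-column n) (column-zero n) ⟩
    0ℚ - (1-x-x² n - √radicand n)
      ≡⟨ solve 2 (λ u a → con 0ℚ :- (u :- (u :+ con (- two) :* a)) := con (- two) :* a) refl (1-x-x² n) (archesℚ n) ⟩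
    - two * archesℚ n ∎
    where open ≡-Reasoning

  denom-column-high : ∀ k n → denom S n (2 ℕ.+ k) ≡ 0ℚ
  denom-column-high k n = begin
    denom S n (2 ℕ.+ k)
      ≡⟨ denom-expand S n (2 ℕ.+ k) ⟩
    (constₛ two n (2 ℕ.+ k) - two * mono 2 0 n (2 ℕ.+ k)) - (Y ·ₛ (((constₛ 1ℚ -ₛ X) -ₛ mono 2 0) -ₛ S)) n (2 ℕ.+ k)
      ≡⟨ cong₂ _-_ (2-2x²-column-suc n (suc k)) (Y-·-suc (((constₛ 1ℚ -ₛ X) -ₛ mono 2 0) -ₛ S) n (suc k)) ⟩
    0ℚ - (((constₛ 1ℚ n (suc k) - X n (suc k)) - mono 2 0 n (suc k)) - S n (suc k))
      ≡⟨ cong₂ (λ a b → 0ℚ - (a - b)) (1-x-x²-column-suc n k) (column-suc k n) ⟩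
    0ℚ ∎
    where open ≡-Reasoning

theorem5 : (S : FPS) → S 0 0 ≡ 1ℚ → S ·ₛ S ≈ₛ radicand →
    (Cgf +ₛ constₛ 1ℚ) ·ₛ denom S ≈ₛ constₛ (ℕtoℚ 2)
theorem5 S S₀₀≡1 S²≡radicand n zero = begin
  ((Cgf +ₛ constₛ 1ℚ) ·ₛ denom S) n 0               ≡⟨ ·ₛ-column-zero (Cgf +ₛ constₛ 1ℚ) (denom S) n ⟩
  (col (Cgf +ₛ constₛ 1ℚ) 0 ⋆ col (denom S) 0) n    ≡⟨ ⋆-cong n (λ i → Cgf+1-paths i 0) denom-column-zero ⟩
  (pathsℚ 0 ⋆ 2-2x²) n                              ≡⟨ ⋆-comm (pathsℚ 0) 2-2x² n ⟩
  (2-2x² ⋆ pathsℚ 0) n                              ≡⟨ paths-equation-zero n ⟩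
  constₛ two n 0                                    ∎
  where
  open ≡-Reasoning
  open SquareRoot S S₀₀≡1 S²≡radicand
theorem5 S S₀₀≡1 S²≡radicand n (suc k) = begin
  ((Cgf +ₛ constₛ 1ℚ) ·ₛ denom S) n (suc k)
    ≡⟨ ·ₛ-column-suc (Cgf +ₛ constₛ 1ℚ) (denom S) denom-column-high n k ⟩
  (col (Cgf +ₛ constₛ 1ℚ) k ⋆ col (denom S) 1) n + (col (Cgf +ₛ constₛ 1ℚ) (suc k) ⋆ col (denom S) 0) n
    ≡⟨ cong₂ _+_ (⋆-cong n (λ i → Cgf+1-paths i k) denom-column-one) (⋆-cong n (λ i → Cgf+1-paths i (suc k)) denom-column-zero) ⟩
  (pathsℚ k ⋆ (λ i → - two * archesℚ i)) n + (pathsℚ (suc k) ⋆ 2-2x²) n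
    ≡⟨ paths-equation-suc k n ⟩
  constₛ two n (suc k) ∎
  where
  open ≡-Reasoning
  open SquareRoot S S₀₀≡1 S²≡radicand
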